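{- Let $n\ge 2$ and let $\pi=n(n-1)(n-2)\cdots 21\,(n+2)(n+3)(n+1)(n+4)\in S_{n+4}$. Then $|q^{ -1}(\pi)|=n+2$, where $q^{ -1}(\pi)=\{\sigma\in S_{n+4}: q(\sigma)=\pi\}$.
   Context: $S_N$ is the set of permutations of $\{1,\dots,N\}$ in one-line notation. An entry $\pi_i$ is a left-to-right (LTR) maximum if $\pi_i>\pi_j$ for all $j<i$. The map $q:S_N\to S_N$ (the algorithm Queuesort, sorting with a queue allowing bypass) is described as follows: let $m_1,\dots,m_r$ be the LTR maxima of $\pi$ from left to right; for $i=r,r-1,\dots,1$ in this order, repeatedly swap $m_i$ with the entry immediately to its right as long as such an entry exists and is smaller than $m_i$; the result is $q(\pi)$ (e.g. $q(21543)=12435$). -}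

module Defs where

open import Data.Nat using (ℕ; zero; suc; _+_; _<ᵇ_; _≡ᵇ_)
open import Data.Bool using (if_then_else_)
open import Data.List using (List; []; _∷_; _++_; foldr; applyUpTo)

-- Permutations of {1,…,N} are represented in one-line notation as lists of ℕ.

oneTo : ℕ → List ℕ
oneTo N = applyUpTo suc N

desc : ℕ → List ℕ
desc zero = []
desc (suc k) = suc k ∷ desc k

-- left-to-right maxima (from left to right); running maximum starts at 0,
-- which is below every entry of a permutation of {1,…,N}
ltrMaxGo : ℕ → List ℕ → List ℕ
ltrMaxGo m [] = []
ltrMaxGo m (x ∷ xs) = if m <ᵇ x then x ∷ ltrMaxGo x xs else ltrMaxGo m xs

ltrMaxima : List ℕ → List ℕ
ltrMaxima = ltrMaxGo 0

push : ℕ → List ℕ → List ℕ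
push v [] = v ∷ []
push v (y ∷ ys) = if y <ᵇ v then y ∷ push v ys else v ∷ y ∷ ys

bubble : ℕ → List ℕ → List ℕ
bubble v [] = []
bubble v (x ∷ xs) = if x ≡ᵇ v then push v xs else x ∷ bubble v xs

-- Queuesort: process LTR maxima m_r, m_{r-1}, …, m_1 in this order
-- (foldr applies the last maximum first)
q : List ℕ → List ℕ
q π = foldr bubble π (ltrMaxima π)

piN : ℕ → List ℕ
piN n = desc n ++ (n + 2 ∷ n + 3 ∷ n + 1 ∷ n + 4 ∷ [])

-- Queuesort can be run from left to right: scanning σ, each new left-to-right maximum x is
-- pushed rightwards through the queuesorted remainder.  Inverting this on π = n ⋯ 1 A B C M,
-- where A = n+2, B = n+3, C = n+1, M = n+4, the first entry x of σ is pushed past the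
-- decreasing prefix n ⋯ 1 and lands inside A B C M; since C < B this forces x = M or x = A.
-- If x = M the rest of σ is already sorted, so σ = M n ⋯ 1 A B C.  If x = A, the rest must
-- queuesort above A to n ⋯ 1 B C M, which by the same analysis happens exactly when it is
-- n ⋯ 1 B C with M inserted at one of the n+1 positions before B.  Hence 1 + (n+1) preimages.
module Submission where

open import Defs
open import Data.Nat using (ℕ; zero; suc; _+_; _≤_; _<_; _<ᵇ_; _≡ᵇ_; s≤s; z<s; s<s)
open import Data.Nat.Properties
open import Data.Bool using (true; false; if_then_else_)
open import Data.List using (List; []; _∷_; _++_; _∷ʳ_; length; map; foldr)
open import Data.List.Properties
  using (∷-injective; ∷-injectiveˡ; ∷-injectiveʳ; ++-cancelʳ; ++-assoc; ++-identityʳ; length-map; applyUpTo-∷ʳ)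
open import Data.List.Relation.Unary.All as All using (All; []; _∷_)
open import Data.List.Relation.Unary.All.Properties using (++⁺)
open import Data.List.Relation.Unary.Any using (here; there)
open import Data.List.Relation.Unary.AllPairs using ([]; _∷_)
open import Data.List.Relation.Unary.Unique.Propositional using (Unique)
import Data.List.Relation.Unary.Unique.Propositional.Properties as Unique
open import Data.List.Membership.Propositional using (_∈_)
open import Data.List.Membership.Propositional.Properties using (∈-map⁺; ∈-map⁻; ∈-applyUpTo⁻)
open import Data.List.Relation.Binary.Permutation.Propositional
  using (_↭_; ↭-refl; ↭-prep; ↭-swap; ↭-trans; ↭-sym; ↭-reflexive; module PermutationReasoning)
open import Data.List.Relation.Binary.Permutation.Propositional.Properties
  using (∈-resp-↭; ++-comm; ++⁺ʳ; ∷↭∷ʳ)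
open import Data.Product using (Σ; _×_; _,_; ∃-syntax)
open import Data.Sum using (_⊎_; inj₁; inj₂)
open import Function.Bundles using (_⇔_; mk⇔)
open import Relation.Nullary using (¬_; yes; no; contradiction)
open import Relation.Nullary.Reflects using (ofʸ; ofⁿ)
open import Relation.Binary.PropositionalEquality
  using (_≡_; _≢_; refl; sym; trans; cong; cong₂; subst; module ≡-Reasoning)

if-< : ∀ {A : Set} {m n} {a b : A} → m < n → (if m <ᵇ n then a else b) ≡ a
if-< {m = m} {n} m<n with m <ᵇ n | <ᵇ-reflects-< m n
... | true  | _       = refl
... | false | ofⁿ m≮n = contradiction m<n m≮n

if-≮ : ∀ {A : Set} {m n} {a b : A} → ¬ m < n → (if m <ᵇ n then a else b) ≡ b
if-≮ {m = m} {n} m≮n with m <ᵇ n | <ᵇ-reflects-< m n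
... | false | _       = refl
... | true  | ofʸ m<n = contradiction m<n m≮n

if-≡ᵇ-refl : ∀ {A : Set} m {a b : A} → (if m ≡ᵇ m then a else b) ≡ a
if-≡ᵇ-refl m with m ≡ᵇ m | ≡⇒≡ᵇ m m refl
... | true | _ = refl

if-≢ : ∀ {A : Set} {m n} {a b : A} → m ≢ n → (if m ≡ᵇ n then a else b) ≡ b
if-≢ {m = m} {n} m≢n with m ≡ᵇ n | ≡ᵇ⇒≡ m n
... | false | _     = refl
... | true  | m≡ᵇn = contradiction (m≡ᵇn _) m≢n

push-< : ∀ {x y} ys → y < x → push x (y ∷ ys) ≡ y ∷ push x ys
push-< _ = if-<

push-≮ : ∀ {x y} ys → ¬ y < x → push x (y ∷ ys) ≡ x ∷ y ∷ ys
push-≮ _ = if-≮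

push≢[] : ∀ x L → push x L ≢ []
push≢[] x []       ()
push≢[] x (y ∷ ys) with y <? x
... | yes y<x rewrite push-< ys y<x = λ ()
... | no  y≮x rewrite push-≮ ys y≮x = λ ()

push-++ : ∀ {x} P R → All (_< x) P → push x (P ++ R) ≡ P ++ push x R
push-++ []      R []         = refl
push-++ (p ∷ P) R (p<x ∷ ps) = trans (push-< (P ++ R) p<x) (cong (p ∷_) (push-++ P R ps))

push-all< : ∀ {x} P → All (_< x) P → push x P ≡ P ∷ʳ x
push-all< {x} P ps = subst (λ L → push x L ≡ P ∷ʳ x) (++-identityʳ P) (push-++ P [] ps)

push≡∷⁻ : ∀ x L {y R} → push x L ≡ y ∷ R →
          (y < x × ∃[ L′ ] (L ≡ y ∷ L′ × push x L′ ≡ R)) ⊎ (y ≡ x × L ≡ R)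
push≡∷⁻ x []       refl = inj₂ (refl , refl)
push≡∷⁻ x (z ∷ zs) e with z <? x
... | yes z<x with ∷-injective (trans (sym (push-< zs z<x)) e)
...   | refl , e′ = inj₁ (z<x , zs , refl , e′)
push≡∷⁻ x (z ∷ zs) e | no z≮x with ∷-injective (trans (sym (push-≮ zs z≮x)) e)
...   | refl , refl = inj₂ (refl , refl)

push-descent⇒< : ∀ x L {a b R} → push x L ≡ a ∷ b ∷ R → b < a → a < x
push-descent⇒< x L e b<a with push≡∷⁻ x L e
... | inj₁ (a<x , _)    = a<x
... | inj₂ (refl , refl) = contradiction (∷-injectiveˡ (trans (sym (push-< _ b<a)) e)) (<⇒≢ b<a)

push≡++⁻ : ∀ x L P {R} → All (_< x) P → push x L ≡ P ++ R →
           ∃[ L′ ] (L ≡ P ++ L′ × push x L′ ≡ R)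
push≡++⁻ x L []      []         e = _ , refl , e
push≡++⁻ x L (p ∷ P) (p<x ∷ ps) e with push≡∷⁻ x L e
... | inj₂ (refl , _) = contradiction p<x (<-irrefl refl)
... | inj₁ (_ , L′ , refl , e′) with push≡++⁻ x L′ P ps e′
...   | L″ , refl , e″ = L″ , refl , e″

-- qFrom m xs is the result of Queuesort on the suffix xs of a permutation whose earlier
-- entries are all at most m.
qFrom : ℕ → List ℕ → List ℕ
qFrom m []       = []
qFrom m (x ∷ xs) = if m <ᵇ x then push x (qFrom x xs) else x ∷ qFrom m xs

qFrom-< : ∀ {m x} xs → m < x → qFrom m (x ∷ xs) ≡ push x (qFrom x xs)
qFrom-< _ = if-<

qFrom-≮ : ∀ {m x} xs → ¬ m < x → qFrom m (x ∷ xs) ≡ x ∷ qFrom m xs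
qFrom-≮ _ = if-≮

qFrom-bounded : ∀ {m} xs → All (_≤ m) xs → qFrom m xs ≡ xs
qFrom-bounded []       []         = refl
qFrom-bounded (x ∷ xs) (x≤m ∷ ps) =
  trans (qFrom-≮ xs (≤⇒≯ x≤m)) (cong (x ∷_) (qFrom-bounded xs ps))

qFrom-max∷ : ∀ {m x} D → m < x → All (_< x) D → qFrom m (x ∷ D) ≡ D ∷ʳ x
qFrom-max∷ {m} {x} D m<x D<x = begin
  qFrom m (x ∷ D)   ≡⟨ qFrom-< D m<x ⟩
  push x (qFrom x D) ≡⟨ cong (push x) (qFrom-bounded D (All.map <⇒≤ D<x)) ⟩
  push x D           ≡⟨ push-all< D D<x ⟩
  D ∷ʳ x             ∎
  where open ≡-Reasoning

qFrom≡⁻ : ∀ m x xs {ys} → qFrom m (x ∷ xs) ≡ ys →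
          (m < x × push x (qFrom x xs) ≡ ys) ⊎ (¬ m < x × x ∷ qFrom m xs ≡ ys)
qFrom≡⁻ m x xs e with m <? x
... | yes m<x = inj₁ (m<x , trans (sym (qFrom-< xs m<x)) e)
... | no  m≮x = inj₂ (m≮x , trans (sym (qFrom-≮ xs m≮x)) e)

ltrMaxGo-> : ∀ m xs → All (m <_) (ltrMaxGo m xs)
ltrMaxGo-> m []       = []
ltrMaxGo-> m (x ∷ xs) with m <ᵇ x | <ᵇ-reflects-< m x
... | true  | ofʸ m<x = m<x ∷ All.map (<-trans m<x) (ltrMaxGo-> x xs)
... | false | _       = ltrMaxGo-> m xs

foldr-bubble-∷ : ∀ x ys vs → All (x ≢_) vs → foldr bubble (x ∷ ys) vs ≡ x ∷ foldr bubble ys vs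
foldr-bubble-∷ x ys []       []           = refl
foldr-bubble-∷ x ys (v ∷ vs) (x≢v ∷ x≢vs) rewrite foldr-bubble-∷ x ys vs x≢vs = if-≢ x≢v

foldr-bubble-ltrMaxGo : ∀ m xs → foldr bubble xs (ltrMaxGo m xs) ≡ qFrom m xs
foldr-bubble-ltrMaxGo m []       = refl
foldr-bubble-ltrMaxGo m (x ∷ xs) with m <ᵇ x | <ᵇ-reflects-< m x
... | true | ofʸ m<x = begin
  bubble x (foldr bubble (x ∷ xs) (ltrMaxGo x xs))
    ≡⟨ cong (bubble x) (foldr-bubble-∷ x xs _ (All.map <⇒≢ (ltrMaxGo-> x xs))) ⟩
  bubble x (x ∷ foldr bubble xs (ltrMaxGo x xs))
    ≡⟨ if-≡ᵇ-refl x ⟩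
  push x (foldr bubble xs (ltrMaxGo x xs))
    ≡⟨ cong (push x) (foldr-bubble-ltrMaxGo x xs) ⟩
  push x (qFrom x xs) ∎
  where open ≡-Reasoning
... | false | ofⁿ m≮x =
  trans (foldr-bubble-∷ x xs _ (All.map (λ m<v → <⇒≢ (≤-<-trans (≮⇒≥ m≮x) m<v)) (ltrMaxGo-> m xs)))
        (cong (x ∷_) (foldr-bubble-ltrMaxGo m xs))

q≡qFrom0 : ∀ xs → q xs ≡ qFrom 0 xs
q≡qFrom0 = foldr-bubble-ltrMaxGo 0

insertions : ∀ {A : Set} → A → List A → List (List A)
insertions x []       = (x ∷ []) ∷ []
insertions x (y ∷ ys) = (x ∷ y ∷ ys) ∷ map (y ∷_) (insertions x ys)

∷∈insertions : ∀ {A : Set} (x : A) ys → (x ∷ ys) ∈ insertions x ys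
∷∈insertions x []      = here refl
∷∈insertions x (_ ∷ _) = here refl

length-insertions : ∀ {A : Set} (x : A) ys → length (insertions x ys) ≡ suc (length ys)
length-insertions x []       = refl
length-insertions x (y ∷ ys) =
  cong suc (trans (length-map (y ∷_) (insertions x ys)) (length-insertions x ys))

insertions-unique : ∀ {A : Set} {x : A} ys → All (x ≢_) ys → Unique (insertions x ys)
insertions-unique []       []           = [] ∷ []
insertions-unique {x = x} (y ∷ ys) (x≢y ∷ x≢ys) =
  All.tabulate head-differs ∷ Unique.map⁺ ∷-injectiveʳ (insertions-unique ys x≢ys)
  where
  head-differs : ∀ {w} → w ∈ map (y ∷_) (insertions x ys) → x ∷ y ∷ ys ≢ w
  head-differs w∈ e with ∈-map⁻ (y ∷_) w∈
  ... | _ , _ , refl = x≢y (∷-injectiveˡ e)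

∈-insertions⇒↭ : ∀ {A : Set} {x : A} ys {w} → w ∈ insertions x ys → w ↭ x ∷ ys
∈-insertions⇒↭ []       (here refl) = ↭-refl
∈-insertions⇒↭ (y ∷ ys) (here refl) = ↭-refl
∈-insertions⇒↭ {x = x} (y ∷ ys) (there w∈) with ∈-map⁻ (y ∷_) w∈
... | w , w∈′ , refl = begin
  y ∷ w       ↭⟨ ↭-prep y (∈-insertions⇒↭ ys w∈′) ⟩
  y ∷ x ∷ ys  ↭⟨ ↭-swap y x ↭-refl ⟩
  x ∷ y ∷ ys  ∎
  where open PermutationReasoning

desc-< : ∀ {k x} → k < x → All (_< x) (desc k)
desc-< {zero}  _   = []
desc-< {suc k} k<x = k<x ∷ desc-< (<-trans (n<1+n k) k<x)

length-desc : ∀ k → length (desc k) ≡ k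
length-desc zero    = refl
length-desc (suc k) = cong suc (length-desc k)

desc-+ : ∀ m k → desc (m + k) ≡ map (m +_) (desc k) ++ desc m
desc-+ m zero    = cong desc (+-identityʳ m)
desc-+ m (suc k) = trans (cong desc (+-suc m k)) (cong₂ _∷_ (sym (+-suc m k)) (desc-+ m k))

oneTo↭desc : ∀ k → oneTo k ↭ desc k
oneTo↭desc zero    = ↭-refl
oneTo↭desc (suc k) = ↭-trans (↭-reflexive (sym (applyUpTo-∷ʳ suc k)))
  (↭-trans (↭-sym (∷↭∷ʳ (suc k) (oneTo k))) (↭-prep (suc k) (oneTo↭desc k)))

↭-oneTo⇒≤ : ∀ {N σ} → σ ↭ oneTo N → All (_≤ N) σ
↭-oneTo⇒≤ σ↭ = All.tabulate λ v∈ → bound (∈-applyUpTo⁻ suc (∈-resp-↭ σ↭ v∈))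
  where
  bound : ∀ {N v} → ∃[ i ] (i < N × v ≡ suc i) → v ≤ N
  bound (_ , i<N , refl) = i<N

-- n is written 2 + m so that desc n, hence π, visibly begins with the descent n, n-1.
module Preimages (m : ℕ) where

  n A B C M : ℕ
  n = 2 + m
  A = n + 2
  B = n + 3
  C = n + 1
  M = n + 4

  n<A : n < A
  n<A = m<m+n n z<s
  n<M : n < M
  n<M = m<m+n n z<s
  A<B : A < B
  A<B = +-monoʳ-< n (s<s (s<s z<s))
  C<B : C < B
  C<B = +-monoʳ-< n (s<s z<s)
  A<M : A < M
  A<M = +-monoʳ-< n (s<s (s<s z<s))
  B<M : B < M
  B<M = +-monoʳ-< n (s<s (s<s (s<s z<s)))
  C<M : C < M
  C<M = +-monoʳ-< n (s<s z<s)

  π : List ℕ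
  π = desc n ++ A ∷ B ∷ C ∷ M ∷ []

  maxFirst : List ℕ
  maxFirst = M ∷ desc n ++ A ∷ B ∷ C ∷ []

  frameABC : List ℕ → List ℕ
  frameABC w = A ∷ w ++ B ∷ C ∷ []

  preimages : List (List ℕ)
  preimages = maxFirst ∷ map frameABC (insertions M (desc n))

  length-preimages : length preimages ≡ n + 2
  length-preimages = begin
    suc (length (map frameABC Ms)) ≡⟨ cong suc (length-map frameABC Ms) ⟩
    suc (length Ms)                ≡⟨ cong suc (length-insertions M (desc n)) ⟩
    suc (suc (length (desc n)))    ≡⟨ cong (λ k → suc (suc k)) (length-desc n) ⟩
    suc (suc n)                    ≡⟨ +-comm 2 n ⟩
    n + 2                          ∎
    where
    Ms : List (List ℕ)
    Ms = insertions M (desc n)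
    open ≡-Reasoning

  preimages-unique : Unique preimages
  preimages-unique =
    All.tabulate maxFirst≢frameABC ∷
    Unique.map⁺ (λ {w} {w′} e → ++-cancelʳ (B ∷ C ∷ []) w w′ (∷-injectiveʳ e))
                (insertions-unique (desc n) (All.map >⇒≢ (desc-< n<M)))
    where
    maxFirst≢frameABC : ∀ {σ} → σ ∈ map frameABC (insertions M (desc n)) → maxFirst ≢ σ
    maxFirst≢frameABC σ∈ e with ∈-map⁻ frameABC {xs = insertions M (desc n)} σ∈
    ... | _ , _ , refl = >⇒≢ A<M (∷-injectiveˡ e)

  oneTo↭ : oneTo M ↭ M ∷ B ∷ A ∷ C ∷ desc n
  oneTo↭ = ↭-trans (oneTo↭desc M) (↭-reflexive (desc-+ n 4))

  maxFirst↭oneTo : maxFirst ↭ oneTo M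
  maxFirst↭oneTo = begin
    maxFirst                     ↭⟨ ↭-prep M (++-comm (desc n) _) ⟩
    M ∷ A ∷ B ∷ C ∷ desc n       ↭⟨ ↭-prep M (↭-swap A B ↭-refl) ⟩
    M ∷ B ∷ A ∷ C ∷ desc n       ↭⟨ ↭-sym oneTo↭ ⟩
    oneTo M                      ∎
    where open PermutationReasoning

  frameABC↭oneTo : ∀ {w} → w ↭ M ∷ desc n → frameABC w ↭ oneTo M
  frameABC↭oneTo {w} w↭ = begin
    A ∷ w ++ B ∷ C ∷ []          ↭⟨ ↭-prep A (++⁺ʳ _ w↭) ⟩
    A ∷ M ∷ desc n ++ B ∷ C ∷ [] ↭⟨ ↭-swap A M (++-comm (desc n) _) ⟩
    M ∷ A ∷ B ∷ C ∷ desc n       ↭⟨ ↭-prep M (↭-swap A B ↭-refl) ⟩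
    M ∷ B ∷ A ∷ C ∷ desc n       ↭⟨ ↭-sym oneTo↭ ⟩
    oneTo M                      ∎
    where open PermutationReasoning

  qFrom-A-M∷ : ∀ k → k ≤ n → qFrom A (M ∷ desc k ++ B ∷ C ∷ []) ≡ desc k ++ B ∷ C ∷ M ∷ []
  qFrom-A-M∷ k k≤n =
    trans (qFrom-max∷ (desc k ++ B ∷ C ∷ []) A<M (++⁺ (desc-< (≤-<-trans k≤n n<M)) (B<M ∷ C<M ∷ [])))
          (++-assoc (desc k) _ _)

  qFrom-A-insertion : ∀ k → k ≤ n → ∀ {w} → w ∈ insertions M (desc k) →
                      qFrom A (w ++ B ∷ C ∷ []) ≡ desc k ++ B ∷ C ∷ M ∷ []
  qFrom-A-insertion zero    k≤n (here refl) = qFrom-A-M∷ zero k≤n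
  qFrom-A-insertion (suc k) k≤n (here refl) = qFrom-A-M∷ (suc k) k≤n
  qFrom-A-insertion (suc k) k≤n (there w∈) with ∈-map⁻ (suc k ∷_) w∈
  ... | w , w∈′ , refl = trans (qFrom-≮ (w ++ B ∷ C ∷ []) (<-asym (≤-<-trans k≤n n<A)))
                               (cong (suc k ∷_) (qFrom-A-insertion k (<⇒≤ k≤n) w∈′))

  qFrom0-maxFirst : qFrom 0 maxFirst ≡ π
  qFrom0-maxFirst =
    trans (qFrom-max∷ (desc n ++ A ∷ B ∷ C ∷ []) z<s (++⁺ (desc-< n<M) (A<M ∷ B<M ∷ C<M ∷ [])))
          (++-assoc (desc n) _ _)

  qFrom0-frameABC : ∀ {w} → w ∈ insertions M (desc n) → qFrom 0 (frameABC w) ≡ π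
  qFrom0-frameABC {w} w∈ = begin
    qFrom 0 (frameABC w)                      ≡⟨ qFrom-< (w ++ B ∷ C ∷ []) z<s ⟩
    push A (qFrom A (w ++ B ∷ C ∷ []))      ≡⟨ cong (push A) (qFrom-A-insertion n ≤-refl w∈) ⟩
    push A (desc n ++ B ∷ C ∷ M ∷ [])       ≡⟨ push-++ (desc n) _ (desc-< n<A) ⟩
    desc n ++ push A (B ∷ C ∷ M ∷ [])       ≡⟨ cong (desc n ++_) (push-≮ _ (<-asym A<B)) ⟩
    π                                       ∎
    where open ≡-Reasoning

  ∈-preimages⇒ : ∀ {σ} → σ ∈ preimages → σ ↭ oneTo M × q σ ≡ π
  ∈-preimages⇒ (here refl) = maxFirst↭oneTo , trans (q≡qFrom0 maxFirst) qFrom0-maxFirst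
  ∈-preimages⇒ (there σ∈) with ∈-map⁻ frameABC {xs = insertions M (desc n)} σ∈
  ... | w , w∈ , refl =
    frameABC↭oneTo (∈-insertions⇒↭ (desc n) w∈) , trans (q≡qFrom0 (frameABC w)) (qFrom0-frameABC w∈)

  push≡BCM⁻ : ∀ x L → push x L ≡ B ∷ C ∷ M ∷ [] → x ≡ M × L ≡ B ∷ C ∷ []
  push≡BCM⁻ x L e with push≡∷⁻ x L e | push-descent⇒< x L e C<B
  ... | inj₂ (refl , _) | B<B = contradiction B<B (<-irrefl refl)
  ... | inj₁ (_ , L₁ , refl , e₁) | B<x with push≡∷⁻ x L₁ e₁
  ...   | inj₂ (refl , _) = contradiction C<B (<-asym B<x)
  ...   | inj₁ (_ , L₂ , refl , e₂) with push≡∷⁻ x L₂ e₂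
  ...     | inj₂ (refl , refl) = refl , refl
  ...     | inj₁ (_ , L₃ , refl , e₃) = contradiction e₃ (push≢[] x L₃)

  push≡ABCM⁻ : ∀ x L → push x L ≡ A ∷ B ∷ C ∷ M ∷ [] →
               (x ≡ M × L ≡ A ∷ B ∷ C ∷ []) ⊎ (x ≡ A × L ≡ B ∷ C ∷ M ∷ [])
  push≡ABCM⁻ x L e with push≡∷⁻ x L e
  ... | inj₂ (refl , refl) = inj₂ (refl , refl)
  ... | inj₁ (_ , L₁ , refl , e₁) with push≡BCM⁻ x L₁ e₁
  ...   | refl , refl = inj₁ (refl , refl)

  qFrom-A⁻ : ∀ k → k ≤ n → ∀ xs → All (_≤ M) xs → qFrom A xs ≡ desc k ++ B ∷ C ∷ M ∷ [] →
             ∃[ w ] (w ∈ insertions M (desc k) × xs ≡ w ++ B ∷ C ∷ [])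
  qFrom-A⁻ zero    _ [] _ ()
  qFrom-A⁻ (suc k) _ [] _ ()
  qFrom-A⁻ k k≤n (y ∷ ys) (_ ∷ ys≤M) e with qFrom≡⁻ A y ys e
  ... | inj₁ (A<y , e′)
    with push≡++⁻ y (qFrom y ys) (desc k) (desc-< (<-trans (≤-<-trans k≤n n<A) A<y)) e′
  ...   | L′ , ys-sorts , e″ with push≡BCM⁻ y L′ e″
  ...     | refl , refl =
    M ∷ desc k , ∷∈insertions M (desc k) , cong (M ∷_) (trans (sym (qFrom-bounded ys ys≤M)) ys-sorts)
  qFrom-A⁻ zero _ (y ∷ ys) _ e | inj₂ (A≮y , e′) =
    contradiction (subst (A <_) (sym (∷-injectiveˡ e′)) A<B) A≮y
  qFrom-A⁻ (suc k) k≤n (y ∷ ys) (_ ∷ ys≤M) e | inj₂ (_ , e′) with ∷-injective e′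
  ... | refl , e″ with qFrom-A⁻ k (<⇒≤ k≤n) ys ys≤M e″
  ...   | w , w∈ , refl = suc k ∷ w , there (∈-map⁺ (suc k ∷_) w∈) , refl

  qFrom0⁻ : ∀ σ → All (_≤ M) σ → qFrom 0 σ ≡ π → σ ∈ preimages
  qFrom0⁻ [] _ ()
  qFrom0⁻ (x ∷ xs) (_ ∷ xs≤M) e with qFrom≡⁻ 0 x xs e
  ... | inj₂ (0≮x , e′) = contradiction (subst (0 <_) (sym (∷-injectiveˡ e′)) z<s) 0≮x
  ... | inj₁ (_ , e′) with push-descent⇒< x (qFrom x xs) e′ (n<1+n (suc m))
  ...   | n<x with push≡++⁻ x (qFrom x xs) (desc n) (desc-< n<x) e′
  ...     | L′ , xs-sorts , e″ with push≡ABCM⁻ x L′ e″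
  ...       | inj₁ (refl , refl) = here (cong (M ∷_) (trans (sym (qFrom-bounded xs xs≤M)) xs-sorts))
  ...       | inj₂ (refl , refl) with qFrom-A⁻ n ≤-refl xs xs≤M xs-sorts
  ...         | w , w∈ , refl = there (∈-map⁺ frameABC w∈)

  ∈-preimages⇐ : ∀ {σ} → σ ↭ oneTo M × q σ ≡ π → σ ∈ preimages
  ∈-preimages⇐ {σ} (σ↭ , qσ≡π) = qFrom0⁻ σ (↭-oneTo⇒≤ σ↭) (trans (sym (q≡qFrom0 σ)) qσ≡π)

proposition4p10 : (n : ℕ) → 2 ≤ n →
    Σ (List (List ℕ)) (λ L → length L ≡ n + 2 × Unique L ×
      ((σ : List ℕ) → (σ ∈ L) ⇔ ((σ ↭ oneTo (n + 4)) × q σ ≡ piN n)))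
proposition4p10 zero          ()
proposition4p10 (suc zero)    (s≤s ())
proposition4p10 (suc (suc m)) _ =
  preimages , length-preimages , preimages-unique , λ _ → mk⇔ ∈-preimages⇒ ∈-preimages⇐
  where open Preimages m
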